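{- For all positive integers $m\le n$, $$\mathrm{mpf}_{m+1,n}(1)=n\cdot \mathrm{mpf}_{m,n}(1)-\mathrm{mpf}_{m-1,n}(1),$$ where $\mathrm{mpf}_{1,n}(1)=n$ and we use the convention $\mathrm{mpf}_{0,n}(1)=1$.
   Context: Let $[n]=\{1,\dots,n\}$. For a nonnegative integer $t$ and positive integers $m,n$, a preference list $\alpha=(a_1,\dots,a_m)\in[n]^m$ is processed by the $t$-metered parking scheme: there are $n$ spots $1,\dots,n$ on a one-way street; cars $1,\dots,m$ arrive in order; car $i$ drives to spot $a_i$, parks there if it is unoccupied, and otherwise parks in the first unoccupied spot numbered greater than $a_i$; if there is none, the car fails to park. Immediately after car $j$ parks, car $j-t$ (if $j-t\ge 1$) leaves the street, vacating its spot. $\alpha$ is a $t$-metered $(m,n)$-parking function if all $m$ cars park. $\mathrm{MPF}_{m,n}(t)$ denotes the set of these and $\mathrm{mpf}_{m,n}(t)=|\mathrm{MPF}_{m,n}(t)|$. -}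

module Defs where

open import Data.Nat using (ℕ; zero; suc; _+_; _∸_; _≤?_; _≟_)
open import Data.Bool using (Bool; true; false; if_then_else_)
open import Data.List using (List; []; _∷_; length; drop; map; concatMap; filter; _++_; [_])
open import Data.List.Membership.DecPropositional _≟_ using (_∈?_)
open import Data.Maybe using (Maybe; just; nothing)
open import Relation.Nullary using (yes; no)

-- Spots are 1..n (natural numbers).  The street state is the list of
-- occupied spots, oldest parked car first.

firstFree : (occ : List ℕ) (a : ℕ) (k : ℕ) → Maybe ℕ
firstFree occ a zero with a ∈? occ
... | yes _ = nothing
... | no  _ = just a
firstFree occ a (suc k) with a ∈? occ
... | yes _ = firstFree occ (suc a) k
... | no  _ = just a

parkSpot : (n : ℕ) (occ : List ℕ) (a : ℕ) → Maybe ℕ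
parkSpot n occ a with a ≤? n
... | yes _ = firstFree occ a (n ∸ a)
... | no  _ = nothing

-- after car j parks, car j - t leaves: the street keeps only the
-- t most recently parked cars
keepLast : ℕ → List ℕ → List ℕ
keepLast t occ = drop (length occ ∸ t) occ

runMetered : (t n : ℕ) (occ : List ℕ) (prefs : List ℕ) → Bool
runMetered t n occ [] = true
runMetered t n occ (a ∷ as) with parkSpot n occ a
... | nothing = false
... | just s  = runMetered t n (keepLast t (occ ++ [ s ])) as

isMPF : (t n : ℕ) → List ℕ → Bool
isMPF t n α = runMetered t n [] α

range1 : ℕ → List ℕ
range1 zero = []
range1 (suc n) = range1 n ++ [ suc n ]

prefLists : (m n : ℕ) → List (List ℕ)
prefLists zero n = [] ∷ []
prefLists (suc m) n = concatMap (λ a → map (a ∷_) (prefLists m n)) (range1 n)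

countTrue : {A : Set} → (A → Bool) → List A → ℕ
countTrue p [] = 0
countTrue p (x ∷ xs) = (if p x then 1 else 0) + countTrue p xs

mpf : (m n t : ℕ) → ℕ
mpf m n t = countTrue (isMPF t n) (prefLists m n)

-- With one-metered parking only the most recently parked car is on the street, so the
-- state is a single occupied spot s.  Let p k s count the length-k lists that park from
-- state s.  A car preferring a ≠ s parks at a, and one preferring s parks at s + 1 if
-- s < n and fails if s = n; splitting on the first preference gives
--   p (k+1) s + p k s = mpf (k+1) + p k (s+1)   (s < n),   p (k+1) n + p k n = mpf (k+1).
-- Summed over s this telescopes to mpf (k+2) + p k 1 = n · mpf (k+1).  The same
-- recurrence shows by induction on k that p k s = mpf k whenever s + k ≤ n, so in
-- particular p k 1 = mpf k for k < n.
module Submission where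

open import Defs
open import Data.Nat as ℕ using (ℕ; zero; suc; _≤_; _<_; _∸_; z≤n; s≤s; _≤?_; _≟_)
import Data.Nat.Properties as ℕ
open import Data.Integer using (+_; _-_; _*_; _⊖_)
import Data.Integer.Properties as ℤ
open import Algebra.Properties.CommutativeSemigroup ℕ.+-commutativeSemigroup
  using (xy∙z≈xz∙y; xy∙z≈x∙zy; x∙yz≈yx∙z)
open import Data.Bool using (Bool; false; if_then_else_)
open import Data.List using (List; []; _∷_; [_]; _++_; map; concatMap)
open import Data.List.Properties using (map-++)
open import Data.Nat.ListAction using (sum)
open import Data.Nat.ListAction.Properties using (sum-++)
open import Data.List.Membership.Propositional using (_∈_; _∉_)
open import Data.List.Membership.DecPropositional _≟_ using (_∈?_)
open import Data.List.Relation.Unary.Any using (here; there)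
open import Data.Maybe using (just; nothing)
open import Data.Empty using (⊥-elim)
open import Relation.Nullary using (yes; no)
open import Relation.Binary.PropositionalEquality
  using (_≡_; refl; sym; trans; cong; cong₂; _≢_; module ≡-Reasoning)
open import Function using (_∘_)

open ≡-Reasoning

firstFree-free : ∀ {occ a} k → a ∉ occ → firstFree occ a k ≡ just a
firstFree-free {occ} {a} zero a∉ with a ∈? occ
... | yes a∈ = ⊥-elim (a∉ a∈)
... | no _   = refl
firstFree-free {occ} {a} (suc k) a∉ with a ∈? occ
... | yes a∈ = ⊥-elim (a∉ a∈)
... | no _   = refl

firstFree-occupied : ∀ {occ a} k → a ∈ occ → firstFree occ a (suc k) ≡ firstFree occ (suc a) k
firstFree-occupied {occ} {a} k a∈ with a ∈? occ
... | yes _  = refl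
... | no a∉ = ⊥-elim (a∉ a∈)

firstFree-full : ∀ {occ a} → a ∈ occ → firstFree occ a zero ≡ nothing
firstFree-full {occ} {a} a∈ with a ∈? occ
... | yes _  = refl
... | no a∉ = ⊥-elim (a∉ a∈)

parkSpot-≤ : ∀ {n occ a} → a ≤ n → parkSpot n occ a ≡ firstFree occ a (n ∸ a)
parkSpot-≤ {n} {occ} {a} a≤n with a ≤? n
... | yes _  = refl
... | no a≰n = ⊥-elim (a≰n a≤n)

parkSpot-free : ∀ {n occ a} → a ≤ n → a ∉ occ → parkSpot n occ a ≡ just a
parkSpot-free {n} {occ} {a} a≤n a∉ = trans (parkSpot-≤ a≤n) (firstFree-free (n ∸ a) a∉)

parkSpot-next : ∀ {n occ a} → a < n → a ∈ occ → suc a ∉ occ → parkSpot n occ a ≡ just (suc a)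
parkSpot-next {n} {occ} {a} a<n a∈ 1+a∉ = begin
  parkSpot n occ a                   ≡⟨ parkSpot-≤ (ℕ.<⇒≤ a<n) ⟩
  firstFree occ a (n ∸ a)            ≡⟨ cong (firstFree occ a) (ℕ.+-∸-assoc 1 a<n) ⟩
  firstFree occ a (suc (n ∸ suc a))  ≡⟨ firstFree-occupied (n ∸ suc a) a∈ ⟩
  firstFree occ (suc a) (n ∸ suc a)  ≡⟨ firstFree-free (n ∸ suc a) 1+a∉ ⟩
  just (suc a)                       ∎

parkSpot-last : ∀ {n occ} → n ∈ occ → parkSpot n occ n ≡ nothing
parkSpot-last {n} {occ} n∈ = begin
  parkSpot n occ n         ≡⟨ parkSpot-≤ {n} ℕ.≤-refl ⟩
  firstFree occ n (n ∸ n)  ≡⟨ cong (firstFree occ n) (ℕ.n∸n≡0 n) ⟩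
  firstFree occ n zero     ≡⟨ firstFree-full n∈ ⟩
  nothing                  ∎

runMetered-park : ∀ {t n occ a s} as → parkSpot n occ a ≡ just s →
  runMetered t n occ (a ∷ as) ≡ runMetered t n (keepLast t (occ ++ [ s ])) as
runMetered-park {t} {n} {occ} {a} as eq with parkSpot n occ a
runMetered-park as refl | just s = refl

runMetered-fail : ∀ {t n occ a} as → parkSpot n occ a ≡ nothing →
  runMetered t n occ (a ∷ as) ≡ false
runMetered-fail {t} {n} {occ} {a} as eq with parkSpot n occ a
runMetered-fail as refl | nothing = refl

private variable A B : Set

countTrue-++ : ∀ (p : A → Bool) xs ys →
  countTrue p (xs ++ ys) ≡ countTrue p xs ℕ.+ countTrue p ys
countTrue-++ p []       ys = refl
countTrue-++ p (x ∷ xs) ys =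
  trans (cong (_ ℕ.+_) (countTrue-++ p xs ys)) (sym (ℕ.+-assoc (if p x then 1 else 0) _ _))

countTrue-cong : ∀ {p q : A → Bool} → (∀ x → p x ≡ q x) → ∀ xs → countTrue p xs ≡ countTrue q xs
countTrue-cong p≗q []       = refl
countTrue-cong p≗q (x ∷ xs) = cong₂ (λ b c → (if b then 1 else 0) ℕ.+ c) (p≗q x) (countTrue-cong p≗q xs)

countTrue-false : ∀ xs → countTrue (λ (_ : A) → false) xs ≡ 0
countTrue-false []       = refl
countTrue-false (x ∷ xs) = countTrue-false xs

countTrue-map : ∀ (p : B → Bool) (f : A → B) xs →
  countTrue p (map f xs) ≡ countTrue (λ x → p (f x)) xs
countTrue-map p f []       = refl
countTrue-map p f (x ∷ xs) = cong (_ ℕ.+_) (countTrue-map p f xs)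

countTrue-concatMap : ∀ (p : B → Bool) (f : A → List B) xs →
  countTrue p (concatMap f xs) ≡ sum (map (λ x → countTrue p (f x)) xs)
countTrue-concatMap p f []       = refl
countTrue-concatMap p f (x ∷ xs) =
  trans (countTrue-++ p (f x) (concatMap f xs)) (cong (_ ℕ.+_) (countTrue-concatMap p f xs))

∑₁ : ℕ → (ℕ → ℕ) → ℕ
∑₁ zero    f = 0
∑₁ (suc n) f = ∑₁ n f ℕ.+ f (suc n)

sum-map-range1 : ∀ (f : ℕ → ℕ) n → sum (map f (range1 n)) ≡ ∑₁ n f
sum-map-range1 f zero    = refl
sum-map-range1 f (suc n) = begin
  sum (map f (range1 n ++ [ suc n ]))          ≡⟨ cong sum (map-++ f (range1 n) [ suc n ]) ⟩
  sum (map f (range1 n) ++ [ f (suc n) ])      ≡⟨ sum-++ (map f (range1 n)) [ f (suc n) ] ⟩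
  sum (map f (range1 n)) ℕ.+ (f (suc n) ℕ.+ 0) ≡⟨ cong₂ ℕ._+_ (sum-map-range1 f n) (ℕ.+-identityʳ _) ⟩
  ∑₁ n f ℕ.+ f (suc n)                         ∎

∑₁-cong : ∀ {f g : ℕ → ℕ} n → (∀ a → 1 ≤ a → a ≤ n → f a ≡ g a) → ∑₁ n f ≡ ∑₁ n g
∑₁-cong zero    f≗g = refl
∑₁-cong (suc n) f≗g =
  cong₂ ℕ._+_ (∑₁-cong n (λ a 1≤a a≤n → f≗g a 1≤a (ℕ.m≤n⇒m≤1+n a≤n))) (f≗g (suc n) (s≤s z≤n) ℕ.≤-refl)

∑₁-update : ∀ {f g : ℕ → ℕ} n s → 1 ≤ s → s ≤ n →
  (∀ a → 1 ≤ a → a ≤ n → a ≢ s → f a ≡ g a) → ∑₁ n f ℕ.+ g s ≡ ∑₁ n g ℕ.+ f s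
∑₁-update zero (suc s) 1≤s () f≗g
∑₁-update {f} {g} (suc n) s 1≤s s≤1+n f≗g with s ≟ suc n
... | yes refl = begin
  ∑₁ n f ℕ.+ f (suc n) ℕ.+ g (suc n)  ≡⟨ xy∙z≈xz∙y (∑₁ n f) (f (suc n)) (g (suc n)) ⟩
  ∑₁ n f ℕ.+ g (suc n) ℕ.+ f (suc n)  ≡⟨ cong (λ x → x ℕ.+ g (suc n) ℕ.+ f (suc n)) ∑f≡∑g ⟩
  ∑₁ n g ℕ.+ g (suc n) ℕ.+ f (suc n)  ∎
  where
  ∑f≡∑g : ∑₁ n f ≡ ∑₁ n g
  ∑f≡∑g = ∑₁-cong n (λ a 1≤a a≤n → f≗g a 1≤a (ℕ.m≤n⇒m≤1+n a≤n) (ℕ.<⇒≢ (s≤s a≤n)))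
... | no s≢1+n = begin
  ∑₁ n f ℕ.+ f (suc n) ℕ.+ g s  ≡⟨ xy∙z≈xz∙y (∑₁ n f) (f (suc n)) (g s) ⟩
  ∑₁ n f ℕ.+ g s ℕ.+ f (suc n)  ≡⟨ cong₂ ℕ._+_ IH (f≗g (suc n) (s≤s z≤n) ℕ.≤-refl (s≢1+n ∘ sym)) ⟩
  ∑₁ n g ℕ.+ f s ℕ.+ g (suc n)  ≡⟨ xy∙z≈xz∙y (∑₁ n g) (f s) (g (suc n)) ⟩
  ∑₁ n g ℕ.+ g (suc n) ℕ.+ f s  ∎
  where
  IH : ∑₁ n f ℕ.+ g s ≡ ∑₁ n g ℕ.+ f s
  IH = ∑₁-update n s 1≤s (ℕ.≤-pred (ℕ.≤∧≢⇒< s≤1+n s≢1+n))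
         (λ a 1≤a a≤n → f≗g a 1≤a (ℕ.m≤n⇒m≤1+n a≤n))

∑₁-telescope : ∀ {f g : ℕ → ℕ} c n → (∀ s → 1 ≤ s → s ≤ n → f s ℕ.+ g s ≡ c ℕ.+ g (suc s)) →
  ∑₁ n f ℕ.+ g 1 ≡ n ℕ.* c ℕ.+ g (suc n)
∑₁-telescope c zero    step = refl
∑₁-telescope {f} {g} c (suc n) step = begin
  ∑₁ n f ℕ.+ f (suc n) ℕ.+ g 1        ≡⟨ xy∙z≈xz∙y (∑₁ n f) (f (suc n)) (g 1) ⟩
  ∑₁ n f ℕ.+ g 1 ℕ.+ f (suc n)        ≡⟨ cong (ℕ._+ f (suc n)) IH ⟩
  n ℕ.* c ℕ.+ g (suc n) ℕ.+ f (suc n)  ≡⟨ xy∙z≈x∙zy (n ℕ.* c) (g (suc n)) (f (suc n)) ⟩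
  n ℕ.* c ℕ.+ (f (suc n) ℕ.+ g (suc n)) ≡⟨ cong (n ℕ.* c ℕ.+_) (step (suc n) (s≤s z≤n) ℕ.≤-refl) ⟩
  n ℕ.* c ℕ.+ (c ℕ.+ g (suc (suc n)))   ≡⟨ x∙yz≈yx∙z (n ℕ.* c) c (g (suc (suc n))) ⟩
  c ℕ.+ n ℕ.* c ℕ.+ g (suc (suc n))     ∎
  where
  IH : ∑₁ n f ℕ.+ g 1 ≡ n ℕ.* c ℕ.+ g (suc n)
  IH = ∑₁-telescope c n (λ s 1≤s s≤n → step s 1≤s (ℕ.m≤n⇒m≤1+n s≤n))

countTrue-prefLists-suc : ∀ (p : List ℕ → Bool) k n →
  countTrue p (prefLists (suc k) n) ≡ ∑₁ n (λ a → countTrue (λ as → p (a ∷ as)) (prefLists k n))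
countTrue-prefLists-suc p k n = begin
  countTrue p (concatMap (λ a → map (a ∷_) (prefLists k n)) (range1 n))
    ≡⟨ countTrue-concatMap p _ (range1 n) ⟩
  sum (map (λ a → countTrue p (map (a ∷_) (prefLists k n))) (range1 n))
    ≡⟨ sum-map-range1 _ n ⟩
  ∑₁ n (λ a → countTrue p (map (a ∷_) (prefLists k n)))
    ≡⟨ ∑₁-cong n (λ a _ _ → countTrue-map p (a ∷_) (prefLists k n)) ⟩
  ∑₁ n (λ a → countTrue (λ as → p (a ∷ as)) (prefLists k n)) ∎

module OneMetered (n : ℕ) where

  parkingFrom : ℕ → ℕ → ℕ
  parkingFrom s k = countTrue (runMetered 1 n [ s ]) (prefLists k n)

  continuations : List ℕ → ℕ → ℕ → ℕ
  continuations occ a k = countTrue (λ as → runMetered 1 n occ (a ∷ as)) (prefLists k n)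

  continuations-park : ∀ occ a {s} k → parkSpot n occ a ≡ just s →
    continuations occ a k ≡ countTrue (runMetered 1 n (keepLast 1 (occ ++ [ s ]))) (prefLists k n)
  continuations-park occ a k parked =
    countTrue-cong (λ as → runMetered-park {occ = occ} {a} as parked) (prefLists k n)

  continuations-fail : ∀ occ a k → parkSpot n occ a ≡ nothing → continuations occ a k ≡ 0
  continuations-fail occ a k failed =
    trans (countTrue-cong (λ as → runMetered-fail {occ = occ} {a} as failed) (prefLists k n))
      (countTrue-false (prefLists k n))

  mpf-suc : ∀ k → mpf (suc k) n 1 ≡ ∑₁ n (λ s → parkingFrom s k)
  mpf-suc k = trans (countTrue-prefLists-suc (runMetered 1 n []) k n)
    (∑₁-cong n (λ a _ a≤n → continuations-park [] a k (parkSpot-free a≤n λ ())))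

  parkingFrom-suc : ∀ s k → 1 ≤ s → s ≤ n →
    parkingFrom s (suc k) ℕ.+ parkingFrom s k ≡ mpf (suc k) n 1 ℕ.+ continuations [ s ] s k
  parkingFrom-suc s k 1≤s s≤n = begin
    parkingFrom s (suc k) ℕ.+ parkingFrom s k
      ≡⟨ cong (ℕ._+ parkingFrom s k) (countTrue-prefLists-suc (runMetered 1 n [ s ]) k n) ⟩
    ∑₁ n (λ a → continuations [ s ] a k) ℕ.+ parkingFrom s k
      ≡⟨ ∑₁-update n s 1≤s s≤n elsewhere ⟩
    ∑₁ n (λ a → parkingFrom a k) ℕ.+ continuations [ s ] s k
      ≡⟨ cong (ℕ._+ continuations [ s ] s k) (mpf-suc k) ⟨
    mpf (suc k) n 1 ℕ.+ continuations [ s ] s k ∎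
    where
    elsewhere : ∀ a → 1 ≤ a → a ≤ n → a ≢ s → continuations [ s ] a k ≡ parkingFrom a k
    elsewhere a _ a≤n a≢s =
      continuations-park [ s ] a k (parkSpot-free a≤n λ { (here a≡s) → a≢s a≡s ; (there ()) })

  parkingFrom-step : ∀ s k → 1 ≤ s → s < n →
    parkingFrom s (suc k) ℕ.+ parkingFrom s k ≡ mpf (suc k) n 1 ℕ.+ parkingFrom (suc s) k
  parkingFrom-step s k 1≤s s<n = trans (parkingFrom-suc s k 1≤s (ℕ.<⇒≤ s<n))
    (cong (mpf (suc k) n 1 ℕ.+_)
      (continuations-park [ s ] s k
        (parkSpot-next s<n (here refl) λ { (here 1+s≡s) → ℕ.1+n≢n 1+s≡s ; (there ()) })))

  parkingFrom-last : ∀ k → 1 ≤ n → parkingFrom n (suc k) ℕ.+ parkingFrom n k ≡ mpf (suc k) n 1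
  parkingFrom-last k 1≤n = trans (parkingFrom-suc n k 1≤n ℕ.≤-refl)
    (trans (cong (mpf (suc k) n 1 ℕ.+_) (continuations-fail [ n ] n k (parkSpot-last {n} (here refl))))
      (ℕ.+-identityʳ _))

  parkingFrom-early : ∀ s i → 1 ≤ s → s ℕ.+ i ≤ n → parkingFrom s i ≡ mpf i n 1
  parkingFrom-early s zero    1≤s s≤n = refl
  parkingFrom-early s (suc i) 1≤s s+1+i≤n = ℕ.+-cancelʳ-≡ (parkingFrom s i) _ _ (begin
    parkingFrom s (suc i) ℕ.+ parkingFrom s i      ≡⟨ parkingFrom-step s i 1≤s s<n ⟩
    mpf (suc i) n 1 ℕ.+ parkingFrom (suc s) i      ≡⟨ cong (mpf (suc i) n 1 ℕ.+_) (trans fromSucS (sym fromS)) ⟩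
    mpf (suc i) n 1 ℕ.+ parkingFrom s i            ∎)
    where
    s<n : s < n
    s<n = ℕ.<-≤-trans (ℕ.m<m+n s (s≤s z≤n)) s+1+i≤n
    fromS : parkingFrom s i ≡ mpf i n 1
    fromS = parkingFrom-early s i 1≤s (ℕ.≤-trans (ℕ.+-monoʳ-≤ s (ℕ.n≤1+n i)) s+1+i≤n)
    fromSucS : parkingFrom (suc s) i ≡ mpf i n 1
    fromSucS = parkingFrom-early (suc s) i (s≤s z≤n)
      (ℕ.≤-trans (ℕ.≤-reflexive (sym (ℕ.+-suc s i))) s+1+i≤n)

open OneMetered

mpf-suc-suc : ∀ n k → 1 ≤ n → mpf (suc (suc k)) n 1 ℕ.+ parkingFrom n 1 k ≡ n ℕ.* mpf (suc k) n 1
mpf-suc-suc (suc n′) k _ = begin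
  mpf (suc (suc k)) n 1 ℕ.+ g 1          ≡⟨ cong (ℕ._+ g 1) (mpf-suc n (suc k)) ⟩
  ∑₁ n′ f ℕ.+ f n ℕ.+ g 1                ≡⟨ xy∙z≈xz∙y (∑₁ n′ f) (f n) (g 1) ⟩
  ∑₁ n′ f ℕ.+ g 1 ℕ.+ f n                ≡⟨ cong (ℕ._+ f n) (∑₁-telescope c n′ step) ⟩
  n′ ℕ.* c ℕ.+ g n ℕ.+ f n               ≡⟨ xy∙z≈x∙zy (n′ ℕ.* c) (g n) (f n) ⟩
  n′ ℕ.* c ℕ.+ (f n ℕ.+ g n)             ≡⟨ cong (n′ ℕ.* c ℕ.+_) (parkingFrom-last n k (s≤s z≤n)) ⟩
  n′ ℕ.* c ℕ.+ c                         ≡⟨ ℕ.+-comm (n′ ℕ.* c) c ⟩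
  n ℕ.* c                                ∎
  where
  n = suc n′
  f g : ℕ → ℕ
  f s = parkingFrom n s (suc k)
  g s = parkingFrom n s k
  c = mpf (suc k) n 1
  step : ∀ s → 1 ≤ s → s ≤ n′ → f s ℕ.+ g s ≡ c ℕ.+ g (suc s)
  step s 1≤s s≤n′ = parkingFrom-step n s k 1≤s (s≤s s≤n′)

m+n≡o⇒+m≡+o-+n : ∀ {m n o} → m ℕ.+ n ≡ o → + m ≡ + o - + n
m+n≡o⇒+m≡+o-+n {m} {n} refl = sym (begin
  + (m ℕ.+ n) - + n  ≡⟨ ℤ.[+m]-[+n]≡m⊖n (m ℕ.+ n) n ⟩
  (m ℕ.+ n) ⊖ n      ≡⟨ ℤ.⊖-≥ (ℕ.m≤n+m n m) ⟩
  + (m ℕ.+ n ∸ n)    ≡⟨ cong +_ (ℕ.m+n∸n≡m m n) ⟩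
  + m                ∎)

theorem3p11 : (m n : ℕ) → 1 ≤ m → m ≤ n →
    + mpf (suc m) n 1 ≡ (+ n) * (+ mpf m n 1) - (+ mpf (m ∸ 1) n 1)
theorem3p11 (suc j) n _ 1+j≤n =
  trans (m+n≡o⇒+m≡+o-+n recurrence) (cong (_- + mpf j n 1) (ℤ.pos-* n (mpf (suc j) n 1)))
  where
  recurrence : mpf (suc (suc j)) n 1 ℕ.+ mpf j n 1 ≡ n ℕ.* mpf (suc j) n 1
  recurrence = trans (cong (mpf (suc (suc j)) n 1 ℕ.+_) (sym (parkingFrom-early n 1 j ℕ.≤-refl 1+j≤n)))
    (mpf-suc-suc n j (ℕ.≤-trans (s≤s z≤n) 1+j≤n))
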